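{- For every graph $G$, $\mathrm{td}_2(G)\le 2\cdot \mathrm{cdd}(M(G))$, where $\mathrm{td}_2$ is the $2$-tree-depth and $\mathrm{cdd}$ is the cd-depth of the cycle matroid $M(G)$.
   Context: Graphs are finite and may have loops and parallel edges. The cycle matroid $M(G)$ has ground set $E(G)$ with acyclic edge sets independent. The blocks of $G$ are the maximal $2$-connected subgraphs and the single edges in the decomposition of the edges of $G$ (corresponding to components of $M(G)$). The $2$-tree-depth is defined by: $\mathrm{td}_2(G)=1$ if $|V(G)|=1$; $\mathrm{td}_2(G)=\max_i \mathrm{td}_2(B_i)$ if $G$ consists of blocks $B_1,\dots,B_k$ with $k>1$; and $\mathrm{td}_2(G)=1+\min_{v\in V(G)}\mathrm{td}_2(G-v)$ if $G\cong K_2$ or $G$ is $2$-connected. A component of a matroid is an inclusion-wise maximal set of elements any two of which lie in a common circuit; $M$ is connected if it has one component. The cd-depth of a matroid $M$ is: $1$ if $|E(M)|\le1$; the maximum cd-depth of the restrictions of $M$ to its components if $M$ is not connected; and if $M$ is connected, $1+$ the minimum cd-depth of $M/e$ or $M\setminus e$ over $e\in E(M)$. -}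

module Defs where

open import Data.Unit using (⊤)
open import Data.Empty using (⊥)
open import Data.Nat using (ℕ; zero; suc)
open import Data.Fin using (Fin; zero; suc; inject₁; fromℕ)
open import Data.Fin.Subset using (Subset; _∈_; _∪_; ⁅_⁆)
open import Data.Product using (Σ; _×_; _,_; proj₁; proj₂)
open import Data.Sum using (_⊎_)
open import Relation.Nullary using (¬_)
open import Relation.Binary.PropositionalEquality using (_≡_; _≢_)
open import Function.Definitions using (Injective)

-- Matroids on (a ground set contained in) Fin m, given by the ground
-- set and the independence predicate on finite subsets of Fin m.
-- Only independence of subsets of the ground set is ever consulted.

record SetSystem (m : ℕ) : Set₁ where
  field
    ground : Fin m → Set
    indep  : Subset m → Set

open SetSystem public

module _ {m : ℕ} where

  IsCircuit : SetSystem m → Subset m → Set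
  IsCircuit M C =
    (∀ x → x ∈ C → ground M x) × ¬ indep M C ×
    (∀ x → x ∈ C → indep M (Data.Fin.Subset._-_ C x))

  SameComp : SetSystem m → Fin m → Fin m → Set
  SameComp M e f = e ≡ f ⊎ Σ (Subset m) (λ C → IsCircuit M C × e ∈ C × f ∈ C)

  component : SetSystem m → Fin m → Fin m → Set
  component M e f = ground M f × SameComp M e f

  Connected : SetSystem m → Set
  Connected M = ∀ {e f} → ground M e → ground M f → SameComp M e f

  AtMostOne : SetSystem m → Set
  AtMostOne M = ∀ {e f} → ground M e → ground M f → e ≡ f

  -- restriction M|C (used for C ⊆ E(M))
  restrict : SetSystem m → (Fin m → Set) → SetSystem m
  restrict M C = record { ground = C ; indep = indep M }

  delete : SetSystem m → Fin m → SetSystem m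
  delete M e = record { ground = λ x → ground M x × x ≢ e ; indep = indep M }

  -- contraction M / e : X is independent iff X is independent and,
  -- if {e} is independent (e not a loop), X ∪ {e} is independent.
  contract : SetSystem m → Fin m → SetSystem m
  contract M e = record
    { ground = λ x → ground M x × x ≢ e
    ; indep  = λ X → indep M X × (indep M ⁅ e ⁆ → indep M (X ∪ ⁅ e ⁆)) }

  -- CDD≤ M k  means  cd-depth(M) ≤ k, following the recursive definition:
  --   1 if |E(M)| ≤ 1; max over components if disconnected;
  --   1 + min over e of cdd(M/e), cdd(M\e) if connected (and |E(M)| ≥ 2).
  data CDD≤ : SetSystem m → ℕ → Set₁ where
    cdd-base : ∀ {M k} → AtMostOne M → CDD≤ M (suc k)
    cdd-disconnected : ∀ {M k} → ¬ AtMostOne M → ¬ Connected M →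
      (∀ e → ground M e → CDD≤ (restrict M (component M e)) k) → CDD≤ M k
    cdd-connected : ∀ {M k} → ¬ AtMostOne M → Connected M →
      (e : Fin m) → ground M e →
      (CDD≤ (contract M e) k ⊎ CDD≤ (delete M e) k) → CDD≤ M (suc k)

-- Graphs: n vertices Fin n, m edges Fin m, each edge with an (ordered)
-- pair of endpoints; loops and parallel edges allowed.

Graph : ℕ → ℕ → Set
Graph n m = Fin m → Fin n × Fin n

module _ {n m : ℕ} (G : Graph n m) where

  Joins : Fin m → Fin n → Fin n → Set
  Joins e a b = G e ≡ (a , b) ⊎ G e ≡ (b , a)

  Incident : Fin m → Fin n → Set
  Incident e v = proj₁ (G e) ≡ v ⊎ proj₂ (G e) ≡ v

  -- a cycle with edges in X: distinct edges e_0..e_len and distinct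
  -- vertices v_0..v_len with e_i joining v_i and v_{i+1}, v_{len+1} = v_0
  -- (len = 0: a loop; len = 1: two parallel edges).
  record Cycle (X : Subset m) : Set where
    field
      len       : ℕ
      vtx       : Fin (suc (suc len)) → Fin n
      edg       : Fin (suc len) → Fin m
      closed    : vtx (fromℕ (suc len)) ≡ vtx zero
      vtx-inj   : Injective _≡_ _≡_ (λ i → vtx (inject₁ i))
      edg-inj   : Injective _≡_ _≡_ edg
      edg-in    : ∀ i → edg i ∈ X
      edg-joins : ∀ i → Joins (edg i) (vtx (inject₁ i)) (vtx (suc i))

  Acyclic : Subset m → Set
  Acyclic X = ¬ Cycle X

  record SubG : Set₁ where
    field
      verts : Fin n → Set
      edges : Fin m → Set

  open SubG public

  fullG : SubG
  fullG = record { verts = λ _ → ⊤ ; edges = λ _ → ⊤ }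

  cycleM : SubG → SetSystem m
  cycleM H = record { ground = edges H ; indep = Acyclic }

  deleteV : SubG → Fin n → SubG
  deleteV H v = record
    { verts = λ x → verts H x × x ≢ v
    ; edges = λ e → edges H e × ¬ Incident e v }

  OneVertex : SubG → Set
  OneVertex H = Σ (Fin n) (λ w → verts H w × (∀ x → verts H x → x ≡ w))

  AtLeastTwoVertices : SubG → Set
  AtLeastTwoVertices H =
    Σ (Fin n) (λ a → Σ (Fin n) (λ b → verts H a × verts H b × a ≢ b))

  Isolated : SubG → Fin n → Set
  Isolated H w = verts H w × (∀ e → edges H e → ¬ Incident e w)

  -- blocks of H: the subgraph of the edges of a component of M(H),
  -- and single isolated vertices
  edgeBlock : SubG → Fin m → SubG
  edgeBlock H e = record
    { verts = λ x → Σ (Fin m) (λ f → component (cycleM H) e f × Incident f x)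
    ; edges = component (cycleM H) e }

  vertexBlock : Fin n → SubG
  vertexBlock w = record { verts = λ x → x ≡ w ; edges = λ _ → ⊥ }

  -- H ≅ K₂ or H is 2-connected: H has ≥ 2 vertices and is a single block,
  -- i.e. no isolated vertices and M(H) connected
  TwoConnOrK2 : SubG → Set
  TwoConnOrK2 H =
    AtLeastTwoVertices H × (∀ w → ¬ Isolated H w) × Connected (cycleM H)

  data TD2≤ : SubG → ℕ → Set₁ where
    td-base : ∀ {H k} → OneVertex H → TD2≤ H (suc k)
    td-blocks : ∀ {H k} → AtLeastTwoVertices H → ¬ TwoConnOrK2 H →
      (∀ w → Isolated H w → TD2≤ (vertexBlock w) k) →
      (∀ e → edges H e → TD2≤ (edgeBlock H e) k) → TD2≤ H k
    td-split : ∀ {H k} → TwoConnOrK2 H → (v : Fin n) → verts H v →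
      TD2≤ (deleteV H v) k → TD2≤ H (suc k)

-- The bound is proved, by induction on the derivation of cdd(M) ≤ k, for every subgraph H of
-- every graph G and every matroid M presented by H (same ground set; independent sets are the
-- forests of H).  If M is disconnected, its components are the edge sets of the blocks of H, and
-- td₂ takes the maximum over blocks just as cdd does over components.  If M is connected, H is a
-- single block and the bound comes from M∖e or M/e.  Deleting an end of e from H leaves a
-- subgraph of H∖e, so td₂(H) ≤ 2 + td₂(H∖e).  If e = pq is not a loop, deleting p and then q
-- leaves a subgraph of H/e, and since deleting one vertex lowers td₂ by at most one,
-- td₂(H) ≤ 2 + td₂(H/e); contracting a loop is deleting it.  Both steps use that td₂ is monotone
-- under subgraphs.  The block decomposition rests on "lying on a common cycle" being transitive,
-- the classical circuit-elimination argument, carried out here with walks.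

module Submission where

open import Defs
open import Data.Nat using (ℕ; zero; suc; _*_; _≤_; _<_; z≤n; s≤s)
import Data.Nat.Properties as ℕ
open import Data.Fin using (Fin; zero; suc; inject₁; fromℕ; toℕ)
open import Data.Fin.Properties
  using (_≟_; any?; all?; injective⇒≤; fromℕ≢inject₁; inject₁-injective; toℕ-inject₁)
open import Data.Fin.Subset using (Subset; _∈_; _∉_; _⊆_; _⊂_; _∪_; _─_; _-_; ⁅_⁆; inside)
open import Data.Fin.Subset.Induction using (⊂-wellFounded; Acc; acc)
open import Data.Fin.Subset.Properties
  using ( _∈?_; x∈⁅x⁆; x∈⁅y⁆⇒x≡y; x≢y⇒x∉⁅y⁆; p─q⊆p; x∈p∧x≢y⇒x∈p-y; x∈p⇒p-x⊂p
        ; p⊆p∪q; q⊆p∪q; x∈p∪q⁺; x∈p∪q⁻; ⊆-trans; anySubset?)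
open import Data.Vec.Base using (_∷_; here; there)
open import Data.Product using (Σ; ∃; _×_; _,_; proj₁; proj₂)
open import Data.Product.Properties using (≡-dec)
open import Data.Sum using (_⊎_; inj₁; inj₂; [_,_]′)
open import Data.Empty using (⊥; ⊥-elim)
open import Data.Unit using (⊤; tt)
open import Relation.Nullary using (¬_; Dec; yes; no)
open import Relation.Nullary.Decidable using (_×-dec_; _⊎-dec_; ¬?; _→-dec_; map′; decidable-stable)
open import Relation.Binary.PropositionalEquality
  using (_≡_; _≢_; refl; sym; trans; cong; cong₂; subst; subst₂)
open import Function.Base using (case_of_)
open import Function.Definitions using (Injective)

x∈p─q⇒x∉q : ∀ {k} {x : Fin k} (p q : Subset k) → x ∈ p ─ q → x ∉ q
x∈p─q⇒x∉q (_ ∷ p) (inside ∷ q) () here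
x∈p─q⇒x∉q (_ ∷ p) (_ ∷ q) (there x∈p─q) (there x∈q) = x∈p─q⇒x∉q p q x∈p─q x∈q

x∈p-y⇒x∈p : ∀ {k} {x y : Fin k} {p : Subset k} → x ∈ p - y → x ∈ p
x∈p-y⇒x∈p {y = y} {p} = p─q⊆p p ⁅ y ⁆

x∈p-y⇒x≢y : ∀ {k} {x y : Fin k} {p : Subset k} → x ∈ p - y → x ≢ y
x∈p-y⇒x≢y {p = p} x∈p-y refl = x∈p─q⇒x∉q p ⁅ _ ⁆ x∈p-y (x∈⁅x⁆ _)

∪-⊆ : ∀ {k} {p q r : Subset k} → p ⊆ r → q ⊆ r → p ∪ q ⊆ r
∪-⊆ {p = p} {q} p⊆r q⊆r x∈p∪q = [ p⊆r , q⊆r ]′ (x∈p∪q⁻ p q x∈p∪q)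

∪-⊂ : ∀ {k} {p q r : Subset k} {x} → p ⊆ r → q ⊆ r → x ∈ r → x ∉ p → x ∉ q → p ∪ q ⊂ r
∪-⊂ {p = p} {q} p⊆r q⊆r x∈r x∉p x∉q = ∪-⊆ p⊆r q⊆r , _ , x∈r , λ x∈p∪q → [ x∉p , x∉q ]′ (x∈p∪q⁻ p q x∈p∪q)

x∈p∪q∧x∉p⇒x∈q : ∀ {k} {p q : Subset k} {x} → x ∈ p ∪ q → x ∉ p → x ∈ q
x∈p∪q∧x∉p⇒x∈q {p = p} {q} x∈p∪q x∉p = [ (λ x∈p → ⊥-elim (x∉p x∈p)) , (λ x∈q → x∈q) ]′ (x∈p∪q⁻ p q x∈p∪q)

x∈p∪q∧x∉q⇒x∈p : ∀ {k} {p q : Subset k} {x} → x ∈ p ∪ q → x ∉ q → x ∈ p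
x∈p∪q∧x∉q⇒x∈p {p = p} {q} x∈p∪q x∉q = [ (λ x∈p → x∈p) , (λ x∈q → ⊥-elim (x∉q x∈q)) ]′ (x∈p∪q⁻ p q x∈p∪q)

p∪q⊆q∪p : ∀ {k} (p q : Subset k) → p ∪ q ⊆ q ∪ p
p∪q⊆q∪p p q = ∪-⊆ (q⊆p∪q q p) (p⊆p∪q p)

module Walks {n m : ℕ} (G : Graph n m) where

  end₁ end₂ : Fin m → Fin n
  end₁ f = proj₁ (G f)
  end₂ f = proj₂ (G f)

  joins-sym : ∀ {f x y} → Joins G f x y → Joins G f y x
  joins-sym (inj₁ eq) = inj₂ eq
  joins-sym (inj₂ eq) = inj₁ eq

  joins? : ∀ f x y → Dec (Joins G f x y)
  joins? f x y = ≡-dec _≟_ _≟_ (G f) (x , y) ⊎-dec ≡-dec _≟_ _≟_ (G f) (y , x)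

  incident? : ∀ f v → Dec (Incident G f v)
  incident? f v = (end₁ f ≟ v) ⊎-dec (end₂ f ≟ v)

  joins⇒incident : ∀ {f x y} → Joins G f x y → Incident G f x
  joins⇒incident (inj₁ eq) = inj₁ (cong proj₁ eq)
  joins⇒incident (inj₂ eq) = inj₂ (cong proj₂ eq)

  joins-loop : ∀ {f x} → Joins G f x x → end₁ f ≡ end₂ f
  joins-loop (inj₁ eq) = trans (cong proj₁ eq) (sym (cong proj₂ eq))
  joins-loop (inj₂ eq) = trans (cong proj₁ eq) (sym (cong proj₂ eq))

  incident-joins : ∀ {f x y v} → Joins G f x y → Incident G f v → v ≡ x ⊎ v ≡ y
  incident-joins (inj₁ eq) (inj₁ refl) = inj₁ (cong proj₁ eq)
  incident-joins (inj₁ eq) (inj₂ refl) = inj₂ (cong proj₂ eq)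
  incident-joins (inj₂ eq) (inj₁ refl) = inj₂ (cong proj₁ eq)
  incident-joins (inj₂ eq) (inj₂ refl) = inj₁ (cong proj₂ eq)

  incident-other : ∀ {f a b x} → Incident G f a → Incident G f b → a ≢ b → Incident G f x → x ≢ a → x ≡ b
  incident-other (inj₁ refl) (inj₁ refl) a≢b _ _ = ⊥-elim (a≢b refl)
  incident-other (inj₁ refl) (inj₂ refl) _ (inj₁ refl) x≢a = ⊥-elim (x≢a refl)
  incident-other (inj₁ refl) (inj₂ refl) _ (inj₂ refl) _ = refl
  incident-other (inj₂ refl) (inj₁ refl) _ (inj₁ refl) _ = refl
  incident-other (inj₂ refl) (inj₁ refl) _ (inj₂ refl) x≢a = ⊥-elim (x≢a refl)
  incident-other (inj₂ refl) (inj₂ refl) a≢b _ _ = ⊥-elim (a≢b refl)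

  data Walk (Z : Fin m → Set) : Fin n → Fin n → Set where
    nil  : ∀ {x} → Walk Z x x
    cons : ∀ {x y z} (f : Fin m) → Z f → Joins G f x y → Walk Z y z → Walk Z x z

  map : ∀ {Z Z' : Fin m → Set} → (∀ {f} → Z f → Z' f) → ∀ {x y} → Walk Z x y → Walk Z' x y
  map h nil = nil
  map h (cons f zf j p) = cons f (h zf) j (map h p)

  module _ {Z : Fin m → Set} where

    _++_ : ∀ {x y z} → Walk Z x y → Walk Z y z → Walk Z x z
    nil ++ q = q
    cons f zf j p ++ q = cons f zf j (p ++ q)

    reverse : ∀ {x y} → Walk Z x y → Walk Z y x
    reverse nil = nil
    reverse (cons f zf j p) = reverse p ++ cons f zf (joins-sym j) nil

    length : ∀ {x y} → Walk Z x y → ℕ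
    length nil = 0
    length (cons _ _ _ p) = suc (length p)

    _∈ᵥ_ : ∀ {x y} → Fin n → Walk Z x y → Set
    _∈ᵥ_ {x} v nil = v ≡ x
    _∈ᵥ_ {x} v (cons _ _ _ p) = v ≡ x ⊎ v ∈ᵥ p

    _∈ₑ_ : ∀ {x y} → Fin m → Walk Z x y → Set
    e ∈ₑ nil = ⊥
    e ∈ₑ cons f _ _ p = e ≡ f ⊎ e ∈ₑ p

    _∈ᵥ?_ : ∀ {x y} v (p : Walk Z x y) → Dec (v ∈ᵥ p)
    _∈ᵥ?_ {x} v nil = v ≟ x
    _∈ᵥ?_ {x} v (cons _ _ _ p) = (v ≟ x) ⊎-dec (v ∈ᵥ? p)

    IsPath : ∀ {x y} → Walk Z x y → Set
    IsPath nil = ⊤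
    IsPath {x} (cons _ _ _ p) = ¬ x ∈ᵥ p × IsPath p

    start∈ᵥ : ∀ {x y} (p : Walk Z x y) → x ∈ᵥ p
    start∈ᵥ nil = refl
    start∈ᵥ (cons _ _ _ p) = inj₁ refl

    dropUntil : ∀ {x y v} (p : Walk Z x y) → IsPath p → v ∈ᵥ p → Σ (Walk Z v y) IsPath
    dropUntil nil _ refl = nil , tt
    dropUntil p@(cons _ _ _ _) p-path (inj₁ refl) = p , p-path
    dropUntil (cons _ _ _ p) (_ , p-path) (inj₂ v∈p) = dropUntil p p-path v∈p

    toPath : ∀ {x y} → Walk Z x y → Σ (Walk Z x y) IsPath
    toPath nil = nil , tt
    toPath {x} (cons f zf j p) with toPath p
    ... | q , q-path with x ∈ᵥ? q
    ...   | yes x∈q = dropUntil q q-path x∈q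
    ...   | no x∉q = cons f zf j q , x∉q , q-path

    incident⇒∈ᵥ : ∀ {x y e v} (p : Walk Z x y) → e ∈ₑ p → Incident G e v → v ∈ᵥ p
    incident⇒∈ᵥ (cons f zf j p) (inj₁ refl) inc with incident-joins j inc
    ... | inj₁ refl = inj₁ refl
    ... | inj₂ refl = inj₂ (start∈ᵥ p)
    incident⇒∈ᵥ (cons f zf j p) (inj₂ e∈p) inc = inj₂ (incident⇒∈ᵥ p e∈p inc)

    path-head∉tail : ∀ {x y z f} (zf : Z f) (j : Joins G f x y) (p : Walk Z y z) →
                     IsPath (cons f zf j p) → ¬ f ∈ₑ p
    path-head∉tail _ j p (x∉p , _) f∈p = x∉p (incident⇒∈ᵥ p f∈p (joins⇒incident j))

    vertexAt : ∀ {x y} (p : Walk Z x y) → Fin (suc (length p)) → Fin n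
    vertexAt {x} p zero = x
    vertexAt (cons _ _ _ p) (suc i) = vertexAt p i

    edgeAt : ∀ {x y} (p : Walk Z x y) → Fin (length p) → Fin m
    edgeAt (cons f _ _ p) zero = f
    edgeAt (cons _ _ _ p) (suc i) = edgeAt p i

    edgeAt∈Z : ∀ {x y} (p : Walk Z x y) i → Z (edgeAt p i)
    edgeAt∈Z (cons f zf _ p) zero = zf
    edgeAt∈Z (cons _ _ _ p) (suc i) = edgeAt∈Z p i

    vertexAt-last : ∀ {x y} (p : Walk Z x y) → vertexAt p (fromℕ (length p)) ≡ y
    vertexAt-last nil = refl
    vertexAt-last (cons _ _ _ p) = vertexAt-last p

    edgeAt-joins : ∀ {x y} (p : Walk Z x y) i →
                   Joins G (edgeAt p i) (vertexAt p (inject₁ i)) (vertexAt p (suc i))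
    edgeAt-joins (cons f _ j p) zero = j
    edgeAt-joins (cons _ _ _ p) (suc i) = edgeAt-joins p i

    vertexAt∈ᵥ : ∀ {x y} (p : Walk Z x y) i → vertexAt p i ∈ᵥ p
    vertexAt∈ᵥ nil zero = refl
    vertexAt∈ᵥ (cons _ _ _ p) zero = inj₁ refl
    vertexAt∈ᵥ (cons _ _ _ p) (suc i) = inj₂ (vertexAt∈ᵥ p i)

    edgeAt∈ₑ : ∀ {x y} (p : Walk Z x y) i → edgeAt p i ∈ₑ p
    edgeAt∈ₑ (cons _ _ _ p) zero = inj₁ refl
    edgeAt∈ₑ (cons _ _ _ p) (suc i) = inj₂ (edgeAt∈ₑ p i)

    vertexAt-injective : ∀ {x y} (p : Walk Z x y) → IsPath p → Injective _≡_ _≡_ (vertexAt p)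
    vertexAt-injective nil _ {zero} {zero} _ = refl
    vertexAt-injective (cons _ _ _ p) _ {zero} {zero} _ = refl
    vertexAt-injective (cons _ _ _ p) (x∉p , _) {zero} {suc j} eq =
      ⊥-elim (x∉p (subst (_∈ᵥ p) (sym eq) (vertexAt∈ᵥ p j)))
    vertexAt-injective (cons _ _ _ p) (x∉p , _) {suc i} {zero} eq =
      ⊥-elim (x∉p (subst (_∈ᵥ p) eq (vertexAt∈ᵥ p i)))
    vertexAt-injective (cons _ _ _ p) (_ , p-path) {suc i} {suc j} eq =
      cong suc (vertexAt-injective p p-path eq)

    edgeAt-injective : ∀ {x y} (p : Walk Z x y) → IsPath p → Injective _≡_ _≡_ (edgeAt p)
    edgeAt-injective (cons _ _ _ p) _ {zero} {zero} _ = refl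
    edgeAt-injective (cons _ zf j′ p) path {zero} {suc j} eq =
      ⊥-elim (path-head∉tail zf j′ p path (subst (_∈ₑ p) (sym eq) (edgeAt∈ₑ p j)))
    edgeAt-injective (cons _ zf j′ p) path {suc i} {zero} eq =
      ⊥-elim (path-head∉tail zf j′ p path (subst (_∈ₑ p) eq (edgeAt∈ₑ p i)))
    edgeAt-injective (cons _ _ _ p) (_ , p-path) {suc i} {suc j} eq =
      cong suc (edgeAt-injective p p-path eq)

    path-length< : ∀ {x y} (p : Walk Z x y) → IsPath p → length p < n
    path-length< p p-path = injective⇒≤ (vertexAt-injective p p-path)

  prefixWalk : ∀ k (V : Fin (suc k) → Fin n) (E : Fin k → Fin m) →
               (∀ i → Joins G (E i) (V (inject₁ i)) (V (suc i))) → (i : Fin (suc k)) →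
               Walk (λ z → ∃ λ j → E j ≡ z × toℕ j < toℕ i) (V zero) (V i)
  prefixWalk k V E J zero = nil
  prefixWalk (suc k) V E J (suc i) =
    cons (E zero) (zero , refl , s≤s z≤n) (J zero)
      (map (λ { (j , eq , lt) → suc j , eq , s≤s lt })
        (prefixWalk k (λ x → V (suc x)) (λ x → E (suc x)) (λ x → J (suc x)) i))

  suffixWalk : ∀ k (V : Fin (suc k) → Fin n) (E : Fin k → Fin m) →
               (∀ i → Joins G (E i) (V (inject₁ i)) (V (suc i))) → (i : Fin (suc k)) →
               Walk (λ z → ∃ λ j → E j ≡ z × toℕ i ≤ toℕ j) (V i) (V (fromℕ k))
  suffixWalk k V E J zero = map (λ { (j , eq , _) → j , eq , z≤n }) (prefixWalk k V E J (fromℕ k))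
  suffixWalk (suc k) V E J (suc i) =
    map (λ { (j , eq , le) → suc j , eq , s≤s le })
      (suffixWalk k (λ x → V (suc x)) (λ x → E (suc x)) (λ x → J (suc x)) i)

  toEnds : ∀ {Z f x y} → Joins G f x y → Walk Z y x → Walk Z (end₂ f) (end₁ f)
  toEnds (inj₁ eq) p = subst₂ (Walk _) (sym (cong proj₂ eq)) (sym (cong proj₁ eq)) p
  toEnds (inj₂ eq) p = subst₂ (Walk _) (sym (cong proj₂ eq)) (sym (cong proj₁ eq)) (reverse p)

  fromEnds : ∀ {Z f x y} → Joins G f x y → Walk Z (end₂ f) (end₁ f) → Walk Z x y
  fromEnds (inj₁ eq) p = subst₂ (Walk _) (cong proj₁ eq) (cong proj₂ eq) (reverse p)
  fromEnds (inj₂ eq) p = subst₂ (Walk _) (cong proj₂ eq) (cong proj₁ eq) p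

  bypass : ∀ {Z Z' : Fin m → Set} {x y} f → Walk Z' (end₂ f) (end₁ f) → Walk Z x y →
           Walk (λ w → (Z w × w ≢ f) ⊎ Z' w) x y
  bypass f d nil = nil
  bypass f d (cons g zg j p) with g ≟ f
  ... | no g≢f = cons g (inj₁ (zg , g≢f)) j (bypass f d p)
  ... | yes refl = fromEnds j (map inj₂ d) ++ bypass f d p

  Detour : (Fin m → Set) → Fin m → Set
  Detour Z f = Walk (λ z → Z z × z ≢ f) (end₂ f) (end₁ f)

  OnCycle : ∀ {X} → Cycle G X → Fin m → Set
  OnCycle c z = ∃ λ j → Cycle.edg c j ≡ z

  onCycle⇒∈ : ∀ {X} (c : Cycle G X) {z} → OnCycle c z → z ∈ X
  onCycle⇒∈ c (j , refl) = Cycle.edg-in c j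

  cycle-detour : ∀ {X} (c : Cycle G X) i → Detour (OnCycle c) (Cycle.edg c i)
  cycle-detour c i =
    toEnds (edg-joins i) (toLast ++ subst (λ v → Walk Z v (vtx (inject₁ i))) (sym closed) fromFirst)
    where
      open Cycle c renaming (len to L)
      Z : Fin m → Set
      Z z = OnCycle c z × z ≢ edg i
      after : ∀ {z} → (∃ λ j → edg j ≡ z × toℕ (suc i) ≤ toℕ j) → Z z
      after (j , refl , le) = (j , refl) , λ eq → ℕ.<-irrefl (sym (cong toℕ (edg-inj eq))) le
      before : ∀ {z} → (∃ λ j → edg j ≡ z × toℕ j < toℕ (inject₁ i)) → Z z
      before (j , refl , lt) =
        (j , refl) , λ eq → ℕ.<-irrefl (trans (cong toℕ (edg-inj eq)) (sym (toℕ-inject₁ i))) lt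
      toLast : Walk Z (vtx (suc i)) (vtx (fromℕ (suc L)))
      toLast = map after (suffixWalk (suc L) vtx edg edg-joins (suc i))
      fromFirst : Walk Z (vtx zero) (vtx (inject₁ i))
      fromFirst = map before (prefixWalk (suc L) vtx edg edg-joins (inject₁ i))

  -- Cycles are built, found and decided through this characterisation rather than through
  -- the indexed Cycle record.
  Bypassed : Subset m → Set
  Bypassed X = ∃ λ f → f ∈ X × Detour (_∈ X) f

  cycle-detour∈ : ∀ {X} (c : Cycle G X) i → Detour (_∈ X) (Cycle.edg c i)
  cycle-detour∈ c i = map (λ { (on , ne) → onCycle⇒∈ c on , ne }) (cycle-detour c i)

  cycleIn : ∀ {X Y} (c : Cycle G X) → (∀ {z} → OnCycle c z → z ∈ Y) → Cycle G Y
  cycleIn c on⇒∈ = record { Cycle c hiding (edg-in) ; edg-in = λ i → on⇒∈ (i , refl) }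

  cycle⇒bypassed : ∀ {X} → Cycle G X → Bypassed X
  cycle⇒bypassed c = Cycle.edg c zero , Cycle.edg-in c zero , cycle-detour∈ c zero

  bypassed⇒cycle : ∀ {X} → Bypassed X → Cycle G X
  bypassed⇒cycle {X} (f , f∈X , w) = record
      { len = length p ; vtx = vtx ; edg = edg ; closed = vertexAt-last p
      ; vtx-inj = vtx-inj ; edg-inj = edg-inj ; edg-in = edg-in ; edg-joins = edg-joins }
    where
      p = proj₁ (toPath w)
      p-path = proj₂ (toPath w)
      vtx : Fin (suc (suc (length p))) → Fin n
      vtx zero = end₁ f
      vtx (suc j) = vertexAt p j
      edg : Fin (suc (length p)) → Fin m
      edg zero = f
      edg (suc j) = edgeAt p j
      end₁∉p : ∀ j → vertexAt p (fromℕ (length p)) ≡ vertexAt p (inject₁ j) → ⊥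
      end₁∉p j eq = fromℕ≢inject₁ {i = j} (vertexAt-injective p p-path eq)
      vtx-inj : Injective _≡_ _≡_ (λ i → vtx (inject₁ i))
      vtx-inj {zero} {zero} _ = refl
      vtx-inj {zero} {suc j} eq = ⊥-elim (end₁∉p j (trans (vertexAt-last p) eq))
      vtx-inj {suc j} {zero} eq = ⊥-elim (end₁∉p j (trans (vertexAt-last p) (sym eq)))
      vtx-inj {suc i} {suc j} eq = cong suc (inject₁-injective (vertexAt-injective p p-path eq))
      edg-inj : Injective _≡_ _≡_ edg
      edg-inj {zero} {zero} _ = refl
      edg-inj {zero} {suc j} eq = ⊥-elim (proj₂ (edgeAt∈Z p j) (sym eq))
      edg-inj {suc i} {zero} eq = ⊥-elim (proj₂ (edgeAt∈Z p i) eq)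
      edg-inj {suc i} {suc j} eq = cong suc (edgeAt-injective p p-path eq)
      edg-in : ∀ i → edg i ∈ X
      edg-in zero = f∈X
      edg-in (suc j) = proj₁ (edgeAt∈Z p j)
      edg-joins : ∀ i → Joins G (edg i) (vtx (inject₁ i)) (vtx (suc i))
      edg-joins zero = inj₁ refl
      edg-joins (suc j) = edgeAt-joins p j

  loop-cycle : ∀ f → end₁ f ≡ end₂ f → Cycle G ⁅ f ⁆
  loop-cycle f loop = bypassed⇒cycle (f , x∈⁅x⁆ f , subst (Walk _ (end₂ f)) (sym loop) nil)

  boundedWalk? : ∀ {Z : Fin m → Set} → (∀ f → Dec (Z f)) → ∀ k x y → Dec (Σ (Walk Z x y) λ p → length p ≤ k)
  boundedWalk? Z? k x y with x ≟ y
  ... | yes refl = yes (nil , z≤n)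
  boundedWalk? Z? zero x y | no x≢y = no λ { (nil , _) → x≢y refl ; (cons _ _ _ _ , ()) }
  boundedWalk? Z? (suc k) x y | no x≢y
    with any? (λ f → any? (λ w → Z? f ×-dec joins? f x w ×-dec boundedWalk? Z? k w y))
  ... | yes (f , w , zf , j , p , le) = yes (cons f zf j p , s≤s le)
  ... | no ∄ = no λ { (nil , _) → x≢y refl
                    ; (cons {y = w} f zf j p , s≤s le) → ∄ (f , w , zf , j , p , le) }

  walk? : ∀ {Z : Fin m → Set} → (∀ f → Dec (Z f)) → ∀ x y → Dec (Walk Z x y)
  walk? Z? x y = map′ proj₁ (λ p → let (q , q-path) = toPath p in q , ℕ.<⇒≤ (path-length< q q-path))
                     (boundedWalk? Z? n x y)

  cycle? : ∀ X → Dec (Cycle G X)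
  cycle? X = map′ bypassed⇒cycle cycle⇒bypassed
                 (any? (λ f → (f ∈? X) ×-dec walk? (λ z → (z ∈? X) ×-dec ¬? (z ≟ f)) (end₂ f) (end₁ f)))

  acyclic? : ∀ X → Dec (Acyclic G X)
  acyclic? X = ¬? (cycle? X)

  dependent⇒cycle : ∀ {X} → ¬ Acyclic G X → Cycle G X
  dependent⇒cycle {X} = decidable-stable (cycle? X)

  acyclic-⊆ : ∀ {X Y} → X ⊆ Y → Acyclic G Y → Acyclic G X
  acyclic-⊆ X⊆Y acyclic c = acyclic (cycleIn c (λ on → X⊆Y (onCycle⇒∈ c on)))

module Circuits {n m : ℕ} (G : Graph n m) where
  open Walks G

  Circuit : Subset m → Set
  Circuit C = ¬ Acyclic G C × (∀ x → x ∈ C → Acyclic G (C - x))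

  circuit-edge-onCycle : ∀ {C z} → Circuit C → (c : Cycle G C) → z ∈ C → OnCycle c z
  circuit-edge-onCycle {z = z} (_ , minimal) c z∈C with any? (λ i → Cycle.edg c i ≟ z)
  ... | yes on = on
  ... | no ¬on = ⊥-elim (minimal z z∈C (cycleIn c λ { (i , refl) →
                    x∈p∧x≢y⇒x∈p-y (Cycle.edg-in c i) (λ eq → ¬on (i , eq)) }))

  circuit-detour : ∀ {C z} → Circuit C → z ∈ C → Detour (_∈ C) z
  circuit-detour {C} circuit@(dependent , _) z∈C =
    let c = dependent⇒cycle dependent
        (i , edg-i≡z) = circuit-edge-onCycle circuit c z∈C
    in subst (Detour (_∈ C)) edg-i≡z (cycle-detour∈ c i)

  -- If y lies on the cycle, the cycle gives it a detour avoiding x; otherwise any edge of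
  -- the cycle can be rerouted around the cycle and dropped from D.
  smaller-detour : ∀ {D x y} → y ∈ D → x ∈ D → Detour (_∈ D) y → Cycle G (D - x) →
                   ∃ λ D' → D' ⊂ D × y ∈ D' × Detour (_∈ D') y
  smaller-detour {D} {x} {y} y∈D x∈D d c with any? (λ i → Cycle.edg c i ≟ y)
  ... | yes (i , refl) = D - x , x∈p⇒p-x⊂p x∈D , Cycle.edg-in c i , cycle-detour∈ c i
  ... | no y∉c = D - w , x∈p⇒p-x⊂p w∈D , x∈p∧x≢y⇒x∈p-y y∈D (λ { refl → y∉c (zero , refl) }) ,
                 map reroute (bypass w (cycle-detour c zero) d)
    where
      w = Cycle.edg c zero
      w∈D = x∈p-y⇒x∈p (Cycle.edg-in c zero)
      reroute : ∀ {z} → ((z ∈ D × z ≢ y) × z ≢ w) ⊎ (OnCycle c z × z ≢ w) → z ∈ D - w × z ≢ y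
      reroute (inj₁ ((z∈D , z≢y) , z≢w)) = x∈p∧x≢y⇒x∈p-y z∈D z≢w , z≢y
      reroute (inj₂ ((j , refl) , z≢w)) =
        x∈p∧x≢y⇒x∈p-y (x∈p-y⇒x∈p (Cycle.edg-in c j)) z≢w , λ eq → y∉c (j , eq)

  circuit-through : ∀ {D y} → y ∈ D → Detour (_∈ D) y → ∃ λ C → C ⊆ D × y ∈ C × Circuit C
  circuit-through {D} = go (⊂-wellFounded D)
    where
      go : ∀ {D y} → Acc _⊂_ D → y ∈ D → Detour (_∈ D) y → ∃ λ C → C ⊆ D × y ∈ C × Circuit C
      go {D} {y} (acc smaller) y∈D d with any? (λ x → (x ∈? D) ×-dec ¬? (acyclic? (D - x)))
      ... | yes (x , x∈D , dependent) =
        let (D' , D'⊂D , y∈D' , d') = smaller-detour y∈D x∈D d (dependent⇒cycle dependent)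
            (C , C⊆D' , y∈C , circuit) = go (smaller D'⊂D) y∈D' d'
        in C , (λ z∈C → proj₁ D'⊂D (C⊆D' z∈C)) , y∈C , circuit
      ... | no ∄ = D , (λ z∈D → z∈D) , y∈D , (λ acyclic → acyclic (bypassed⇒cycle (y , y∈D , d))) ,
                   λ x x∈D → decidable-stable (acyclic? (D - x)) (λ dependent → ∄ (x , x∈D , dependent))

  circuit-elim : ∀ {C₁ C₂ x y} → Circuit C₁ → Circuit C₂ → x ∈ C₂ → y ∈ C₁ → y ∉ C₂ →
                 ∃ λ C → C ⊆ C₁ ∪ C₂ × x ∉ C × y ∈ C × Circuit C
  circuit-elim {C₁} {C₂} {x} {y} c₁ c₂ x∈C₂ y∈C₁ y∉C₂ =
    let (C , C⊆D , y∈C , circuit) = circuit-through y∈D d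
    in C , (λ z∈C → x∈p-y⇒x∈p (C⊆D z∈C)) , (λ x∈C → x∈p-y⇒x≢y (C⊆D x∈C) refl) , y∈C , circuit
    where
      D = (C₁ ∪ C₂) - x
      y∈D = x∈p∧x≢y⇒x∈p-y (x∈p∪q⁺ (inj₁ y∈C₁)) (λ { refl → y∉C₂ x∈C₂ })
      reroute : ∀ {z} → ((z ∈ C₁ × z ≢ y) × z ≢ x) ⊎ (z ∈ C₂ × z ≢ x) → z ∈ D × z ≢ y
      reroute (inj₁ ((z∈C₁ , z≢y) , z≢x)) = x∈p∧x≢y⇒x∈p-y (x∈p∪q⁺ (inj₁ z∈C₁)) z≢x , z≢y
      reroute (inj₂ (z∈C₂ , z≢x)) = x∈p∧x≢y⇒x∈p-y (x∈p∪q⁺ (inj₂ z∈C₂)) z≢x , λ { refl → y∉C₂ z∈C₂ }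
      d = map reroute (bypass x (circuit-detour c₂ x∈C₂) (circuit-detour c₁ y∈C₁))

  circuit-⊈ : ∀ {C₁ C₃ f} → Circuit C₁ → Circuit C₃ → f ∈ C₁ → f ∉ C₃ → ∃ λ h → h ∈ C₃ × h ∉ C₁
  circuit-⊈ {C₁} {C₃} {f} (_ , minimal₁) (dependent₃ , _) f∈C₁ f∉C₃
    with any? (λ h → (h ∈? C₃) ×-dec ¬? (h ∈? C₁))
  ... | yes found = found
  ... | no ∄ = ⊥-elim (dependent₃ (acyclic-⊆ C₃⊆C₁-f (minimal₁ f f∈C₁)))
    where
      C₃⊆C₁-f : C₃ ⊆ C₁ - f
      C₃⊆C₁-f {z} z∈C₃ = x∈p∧x≢y⇒x∈p-y (decidable-stable (z ∈? C₁) (λ z∉C₁ → ∄ (z , z∈C₃ , z∉C₁)))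
                                        (λ { refl → f∉C₃ z∈C₃ })

  CircuitIn : Subset m → Fin m → Fin m → Set
  CircuitIn U e g = ∃ λ C → C ⊆ U × e ∈ C × g ∈ C × Circuit C

  TransitiveBelow : Subset m → Set
  TransitiveBelow U = ∀ {C₁ C₂ e f g} → C₁ ∪ C₂ ⊂ U → Circuit C₁ → Circuit C₂ →
                      e ∈ C₁ → f ∈ C₁ → f ∈ C₂ → g ∈ C₂ → CircuitIn U e g

  -- Eliminating f gives circuits C₃ ∋ e and C₄ ∋ g avoiding f, so C₃ ⊈ C₁ and C₄ ⊈ C₂.
  -- Either C₄ misses some z ∈ C₂ ∖ C₁: then C₁ and C₄ meet and C₁ ∪ C₄ misses z.  Or
  -- C₂ ∖ C₁ ⊆ C₄: then C₃ and C₄ meet and C₃ ∪ C₄ misses f.  Either way the induction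
  -- applies to a union strictly below C₁ ∪ C₂.
  circuit-trans-step : ∀ {C₁ C₂ e f g} → TransitiveBelow (C₁ ∪ C₂) → Circuit C₁ → Circuit C₂ →
                       e ∈ C₁ → f ∈ C₁ → f ∈ C₂ → g ∈ C₂ → g ∉ C₁ → e ∉ C₂ → CircuitIn (C₁ ∪ C₂) e g
  circuit-trans-step {C₁} {C₂} {e} {f} {g} ih c₁ c₂ e∈C₁ f∈C₁ f∈C₂ g∈C₂ g∉C₁ e∉C₂ =
    let (C₃ , C₃⊆C₁∪C₂ , f∉C₃ , e∈C₃ , c₃) = circuit-elim c₁ c₂ f∈C₂ e∈C₁ e∉C₂
        (C₄ , C₄⊆C₂∪C₁ , f∉C₄ , g∈C₄ , c₄) = circuit-elim c₂ c₁ f∈C₁ g∈C₂ g∉C₁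
        C₄⊆C₁∪C₂ = ⊆-trans C₄⊆C₂∪C₁ (p∪q⊆q∪p C₂ C₁)
    in case any? (λ z → (z ∈? C₂) ×-dec ¬? (z ∈? C₁) ×-dec ¬? (z ∈? C₄)) of λ where
      (yes (z , z∈C₂ , z∉C₁ , z∉C₄)) →
        let (h , h∈C₄ , h∉C₂) = circuit-⊈ c₂ c₄ f∈C₂ f∉C₄
        in ih (∪-⊂ (p⊆p∪q C₂) C₄⊆C₁∪C₂ (q⊆p∪q C₁ C₂ z∈C₂) z∉C₁ z∉C₄)
              c₁ c₄ e∈C₁ (x∈p∪q∧x∉p⇒x∈q (C₄⊆C₂∪C₁ h∈C₄) h∉C₂) h∈C₄ g∈C₄
      (no ∄) →
        let (h , h∈C₃ , h∉C₁) = circuit-⊈ c₁ c₃ f∈C₁ f∉C₃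
            h∈C₂ = x∈p∪q∧x∉p⇒x∈q (C₃⊆C₁∪C₂ h∈C₃) h∉C₁
            h∈C₄ = decidable-stable (h ∈? C₄) (λ h∉C₄ → ∄ (h , h∈C₂ , h∉C₁ , h∉C₄))
        in ih (∪-⊂ C₃⊆C₁∪C₂ C₄⊆C₁∪C₂ (p⊆p∪q C₂ f∈C₁) f∉C₃ f∉C₄) c₃ c₄ e∈C₃ h∈C₃ h∈C₄ g∈C₄

  circuit-trans : ∀ {C₁ C₂ e f g} → Circuit C₁ → Circuit C₂ →
                  e ∈ C₁ → f ∈ C₁ → f ∈ C₂ → g ∈ C₂ → CircuitIn (C₁ ∪ C₂) e g
  circuit-trans = go (⊂-wellFounded _)
    where
      go : ∀ {C₁ C₂ e f g} → Acc _⊂_ (C₁ ∪ C₂) → Circuit C₁ → Circuit C₂ →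
           e ∈ C₁ → f ∈ C₁ → f ∈ C₂ → g ∈ C₂ → CircuitIn (C₁ ∪ C₂) e g
      go {C₁} {C₂} {e} {g = g} (acc smaller) c₁ c₂ e∈C₁ f∈C₁ f∈C₂ g∈C₂ with g ∈? C₁ | e ∈? C₂
      ... | yes g∈C₁ | _ = C₁ , p⊆p∪q C₂ , e∈C₁ , g∈C₁ , c₁
      ... | no _ | yes e∈C₂ = C₂ , q⊆p∪q C₁ C₂ , e∈C₂ , g∈C₂ , c₂
      ... | no g∉C₁ | no e∉C₂ = circuit-trans-step ih c₁ c₂ e∈C₁ f∈C₁ f∈C₂ g∈C₂ g∉C₁ e∉C₂
        where
          ih : TransitiveBelow (C₁ ∪ C₂)
          ih {C₃} {C₄} C₃∪C₄⊂ c₃ c₄ e∈C₃ h∈C₃ h∈C₄ g∈C₄ =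
            let (C , C⊆C₃∪C₄ , rest) = go {C₃} {C₄} (smaller C₃∪C₄⊂) c₃ c₄ e∈C₃ h∈C₃ h∈C₄ g∈C₄
            in C , (λ x∈C → proj₁ C₃∪C₄⊂ (C⊆C₃∪C₄ x∈C)) , rest

sameComp-sym : ∀ {m} {M : SetSystem m} {e f} → SameComp M e f → SameComp M f e
sameComp-sym (inj₁ refl) = inj₁ refl
sameComp-sym (inj₂ (C , circuit , e∈C , f∈C)) = inj₂ (C , circuit , f∈C , e∈C)

NonEmpty : ∀ {n m} {G : Graph n m} → SubG G → Set
NonEmpty H = ∃ (verts H)

module Subgraphs {n m : ℕ} (G : Graph n m) where
  open Walks G
  open Circuits G

  record IsDecSubgraph (H : SubG G) : Set where
    field
      verts? : ∀ x → Dec (verts H x)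
      edges? : ∀ f → Dec (edges H f)
      ends∈  : ∀ {f} → edges H f → verts H (end₁ f) × verts H (end₂ f)

  open IsDecSubgraph public

  fullG-isDec : IsDecSubgraph (fullG G)
  fullG-isDec = record { verts? = λ _ → yes tt ; edges? = λ _ → yes tt ; ends∈ = λ _ → tt , tt }

  sameComp-trans : ∀ {H e f g} → SameComp (cycleM G H) e f → SameComp (cycleM G H) f g →
                   SameComp (cycleM G H) e g
  sameComp-trans (inj₁ refl) f~g = f~g
  sameComp-trans e~f (inj₁ refl) = e~f
  sameComp-trans (inj₂ (C₁ , (C₁⊆H , c₁) , e∈C₁ , f∈C₁)) (inj₂ (C₂ , (C₂⊆H , c₂) , f∈C₂ , g∈C₂)) =
    let (C , C⊆C₁∪C₂ , e∈C , g∈C , c) = circuit-trans c₁ c₂ e∈C₁ f∈C₁ f∈C₂ g∈C₂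
        C⊆H = λ x x∈C → [ C₁⊆H x , C₂⊆H x ]′ (x∈p∪q⁻ C₁ C₂ (C⊆C₁∪C₂ x∈C))
    in inj₂ (C , (C⊆H , c) , e∈C , g∈C)

  edgeBlock-connected : ∀ {H e} → Connected (cycleM G (edgeBlock G H e))
  edgeBlock-connected {H} {e} {f} {g} (_ , e~f) (_ , e~g)
    with sameComp-trans {H} (sameComp-sym {M = cycleM G H} e~f) e~g
  ... | inj₁ f≡g = inj₁ f≡g
  ... | inj₂ (C , (C⊆H , c) , f∈C , g∈C) = inj₂ (C , (C⊆B , c) , f∈C , g∈C)
    where
      C⊆B : ∀ x → x ∈ C → edges (edgeBlock G H e) x
      C⊆B x x∈C = C⊆H x x∈C , sameComp-trans {H} e~f (inj₂ (C , (C⊆H , c) , f∈C , x∈C))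

  edgeBlock-noIsolated : ∀ {H e} w → ¬ Isolated G (edgeBlock G H e) w
  edgeBlock-noIsolated w ((f , f∈B , incident) , ¬incident) = ¬incident f f∈B incident

  vertexBlock-oneVertex : ∀ w → OneVertex G (vertexBlock G w)
  vertexBlock-oneVertex w = w , refl , λ _ x≡w → x≡w

  twoConn-nonEmpty : ∀ {H} → TwoConnOrK2 G H → NonEmpty H
  twoConn-nonEmpty ((a , _ , a∈H , _) , _) = a , a∈H

  deleteV-nonEmpty : ∀ {H} → AtLeastTwoVertices G H → ∀ v → NonEmpty (deleteV G H v)
  deleteV-nonEmpty (a , b , a∈H , b∈H , a≢b) v with a ≟ v
  ... | yes refl = b , b∈H , λ b≡a → a≢b (sym b≡a)
  ... | no a≢v = a , a∈H , a≢v

  deleteV-isDec : ∀ {H} → IsDecSubgraph H → ∀ v → IsDecSubgraph (deleteV G H v)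
  deleteV-isDec ds v = record
    { verts? = λ x → verts? ds x ×-dec ¬? (x ≟ v)
    ; edges? = λ f → edges? ds f ×-dec ¬? (incident? f v)
    ; ends∈  = λ (f∈H , ¬incident) → (proj₁ (ends∈ ds f∈H) , λ eq → ¬incident (inj₁ eq)) ,
                                      (proj₂ (ends∈ ds f∈H) , λ eq → ¬incident (inj₂ eq)) }

  module _ {H : SubG G} (ds : IsDecSubgraph H) where

    incident⇒verts : ∀ {f v} → edges H f → Incident G f v → verts H v
    incident⇒verts f∈H (inj₁ refl) = proj₁ (ends∈ ds f∈H)
    incident⇒verts f∈H (inj₂ refl) = proj₂ (ends∈ ds f∈H)

    circuit? : ∀ C → Dec (IsCircuit (cycleM G H) C)
    circuit? C = all? (λ x → (x ∈? C) →-dec edges? ds x) ×-dec ¬? (acyclic? C) ×-dec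
                 all? (λ x → (x ∈? C) →-dec acyclic? (C - x))

    sameComp? : ∀ e f → Dec (SameComp (cycleM G H) e f)
    sameComp? e f = (e ≟ f) ⊎-dec anySubset? (λ C → circuit? C ×-dec (e ∈? C) ×-dec (f ∈? C))

    connected? : Dec (Connected (cycleM G H))
    connected? with all? (λ e → all? (λ f → edges? ds e →-dec (edges? ds f →-dec sameComp? e f)))
    ... | yes all~ = yes (λ {e} {f} e∈H f∈H → all~ e f e∈H f∈H)
    ... | no ¬all~ = no (λ conn → ¬all~ (λ e f e∈H f∈H → conn e∈H f∈H))

    isolated? : ∀ w → Dec (Isolated G H w)
    isolated? w = verts? ds w ×-dec all? (λ f → edges? ds f →-dec ¬? (incident? f w))

    atLeastTwo? : Dec (AtLeastTwoVertices G H)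
    atLeastTwo? = any? (λ a → any? (λ b → verts? ds a ×-dec verts? ds b ×-dec ¬? (a ≟ b)))

    twoConnOrK2? : Dec (TwoConnOrK2 G H)
    twoConnOrK2? = atLeastTwo? ×-dec all? (λ w → ¬? (isolated? w)) ×-dec connected?

    incidentEdge : ∀ {v} → verts H v → ¬ Isolated G H v → ∃ λ f → edges H f × Incident G f v
    incidentEdge {v} v∈H ¬isolated =
      decidable-stable (any? (λ f → edges? ds f ×-dec incident? f v))
                       (λ ∄ → ¬isolated (v∈H , λ f f∈H incident → ∄ (f , f∈H , incident)))

    oneVertex : NonEmpty H → ¬ AtLeastTwoVertices G H → OneVertex G H
    oneVertex (w , w∈H) ¬two = w , w∈H , λ x x∈H →
      decidable-stable (x ≟ w) (λ x≢w → ¬two (x , w , x∈H , w∈H , x≢w))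

  module _ {H : SubG G} (ds : IsDecSubgraph H) where

    edgeBlock-isDec : ∀ e → IsDecSubgraph (edgeBlock G H e)
    edgeBlock-isDec e = record
      { verts? = λ x → any? (λ f → (edges? ds f ×-dec sameComp? ds e f) ×-dec incident? f x)
      ; edges? = λ f → edges? ds f ×-dec sameComp? ds e f
      ; ends∈  = λ f∈B → (_ , f∈B , inj₁ refl) , (_ , f∈B , inj₂ refl) }

    edgeBlock-verts⊆ : ∀ {e x} → verts (edgeBlock G H e) x → verts H x
    edgeBlock-verts⊆ (f , (f∈H , _) , incident) = incident⇒verts ds f∈H incident

    edgeBlock-isBlock : ∀ {e} → edges H e → OneVertex G (edgeBlock G H e) ⊎ TwoConnOrK2 G (edgeBlock G H e)
    edgeBlock-isBlock {e} e∈H with atLeastTwo? (edgeBlock-isDec e)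
    ... | no ¬two = inj₁ (oneVertex (edgeBlock-isDec e) (end₁ e , e , (e∈H , inj₁ refl) , inj₁ refl) ¬two)
    ... | yes two = inj₂ (two , edgeBlock-noIsolated {H} {e} , edgeBlock-connected {H} {e})

  td-byBlocks : ∀ {H k} → IsDecSubgraph H → NonEmpty H →
                (TwoConnOrK2 G H → TD2≤ G H (suc k)) →
                (∀ {e} → edges H e → TwoConnOrK2 G (edgeBlock G H e) → TD2≤ G (edgeBlock G H e) (suc k)) →
                TD2≤ G H (suc k)
  td-byBlocks {H} {k} ds ne td-H td-block with atLeastTwo? ds
  ... | no ¬two = td-base (oneVertex ds ne ¬two)
  ... | yes two with twoConnOrK2? ds
  ...   | yes tc = td-H tc
  ...   | no ¬tc = td-blocks two ¬tc (λ w _ → td-base (vertexBlock-oneVertex w)) td-edgeBlock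
    where
      td-edgeBlock : ∀ e → edges H e → TD2≤ G (edgeBlock G H e) (suc k)
      td-edgeBlock e e∈H = [ td-base , td-block e∈H ]′ (edgeBlock-isBlock ds e∈H)

  td-suc : ∀ {H k} → TD2≤ G H k → TD2≤ G H (suc k)
  td-suc (td-base one) = td-base one
  td-suc (td-blocks two ¬tc td-isolated td-edge) =
    td-blocks two ¬tc (λ w iso → td-suc (td-isolated w iso)) (λ e e∈H → td-suc (td-edge e e∈H))
  td-suc (td-split tc v v∈H td) = td-split tc v v∈H (td-suc td)

  td-0⇒empty : ∀ {H x} → TD2≤ G H 0 → ¬ verts H x
  td-0⇒empty {H} {x} (td-blocks _ _ td-isolated td-edge) x∈H = ¬isolated
      (x∈H , λ f f∈H incident → td-0⇒empty (td-edge f f∈H) (f , (f∈H , inj₁ refl) , incident))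
    where
      ¬isolated : ¬ Isolated G H x
      ¬isolated isolated = td-0⇒empty (td-isolated x isolated) refl

infix 4 _⊑_

record _⊑_ {n m : ℕ} {G₁ G₂ : Graph n m} (H₁ : SubG G₁) (H₂ : SubG G₂) : Set where
  field
    verts⊆ : ∀ {x} → verts H₁ x → verts H₂ x
    edges⊆ : ∀ {f} → edges H₁ f → edges H₂ f
    agree  : ∀ {f} → edges H₁ f → G₁ f ≡ G₂ f

open _⊑_ public

module Monotonicity {n m : ℕ} where
  open Subgraphs

  joins-transport : ∀ (G₁ G₂ : Graph n m) {f a b} → G₁ f ≡ G₂ f → Joins G₁ f a b → Joins G₂ f a b
  joins-transport _ _ {a = a} {b} = subst (λ ends → ends ≡ (a , b) ⊎ ends ≡ (b , a))

  incident-transport : ∀ (G₁ G₂ : Graph n m) {f v} → G₁ f ≡ G₂ f → Incident G₁ f v → Incident G₂ f v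
  incident-transport _ _ {v = v} = subst (λ ends → proj₁ ends ≡ v ⊎ proj₂ ends ≡ v)

  acyclic-transport : ∀ {G₁ G₂ : Graph n m} {X} → (∀ {f} → f ∈ X → G₁ f ≡ G₂ f) →
                      Acyclic G₁ X → Acyclic G₂ X
  acyclic-transport {G₁} {G₂} agree acyclic c = acyclic (record
    { Cycle c hiding (edg-joins)
    ; edg-joins = λ i → joins-transport G₂ G₁ (sym (agree (Cycle.edg-in c i))) (Cycle.edg-joins c i) })

  sameComp-⊑ : ∀ {G₁ G₂ : Graph n m} {H₁ : SubG G₁} {H₂ : SubG G₂} {e f} → H₁ ⊑ H₂ →
               SameComp (cycleM G₁ H₁) e f → SameComp (cycleM G₂ H₂) e f
  sameComp-⊑ _ (inj₁ e≡f) = inj₁ e≡f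
  sameComp-⊑ H₁⊑H₂ (inj₂ (C , (C⊆H₁ , dependent , minimal) , e∈C , f∈C)) =
    inj₂ (C , (C⊆H₂ , dependent₂ , minimal₂) , e∈C , f∈C)
    where
      C⊆H₂ = λ x x∈C → edges⊆ H₁⊑H₂ (C⊆H₁ x x∈C)
      dependent₂ = λ acyclic₂ →
        dependent (acyclic-transport (λ f∈C → sym (agree H₁⊑H₂ (C⊆H₁ _ f∈C))) acyclic₂)
      minimal₂ = λ x x∈C →
        acyclic-transport (λ f∈C-x → agree H₁⊑H₂ (C⊆H₁ _ (x∈p-y⇒x∈p f∈C-x))) (minimal x x∈C)

  module _ {G₁ G₂ : Graph n m} {H₁ : SubG G₁} {H₂ : SubG G₂} where

    ⊑-incident : ∀ {f v} → H₁ ⊑ H₂ → edges H₁ f → Incident G₁ f v → Incident G₂ f v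
    ⊑-incident H₁⊑H₂ f∈H₁ = incident-transport G₁ G₂ (agree H₁⊑H₂ f∈H₁)

    ⊑-incident⁻ : ∀ {f v} → H₁ ⊑ H₂ → edges H₁ f → Incident G₂ f v → Incident G₁ f v
    ⊑-incident⁻ H₁⊑H₂ f∈H₁ = incident-transport G₂ G₁ (sym (agree H₁⊑H₂ f∈H₁))

    ⊑-nonEmpty : H₁ ⊑ H₂ → NonEmpty H₁ → NonEmpty H₂
    ⊑-nonEmpty H₁⊑H₂ (x , x∈H₁) = x , verts⊆ H₁⊑H₂ x∈H₁

    ⊑-deleteV : ∀ {v} → H₁ ⊑ H₂ → deleteV G₁ H₁ v ⊑ deleteV G₂ H₂ v
    ⊑-deleteV H₁⊑H₂ = record
      { verts⊆ = λ (x∈H₁ , x≢v) → verts⊆ H₁⊑H₂ x∈H₁ , x≢v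
      ; edges⊆ = λ (f∈H₁ , ¬incident) → edges⊆ H₁⊑H₂ f∈H₁ ,
                   λ incident → ¬incident (⊑-incident⁻ H₁⊑H₂ f∈H₁ incident)
      ; agree  = λ (f∈H₁ , _) → agree H₁⊑H₂ f∈H₁ }

    ⊑-deleteV-absent : ∀ {v} → IsDecSubgraph G₁ H₁ → H₁ ⊑ H₂ → ¬ verts H₁ v → H₁ ⊑ deleteV G₂ H₂ v
    ⊑-deleteV-absent ds H₁⊑H₂ v∉H₁ = record
      { verts⊆ = λ x∈H₁ → verts⊆ H₁⊑H₂ x∈H₁ , λ { refl → v∉H₁ x∈H₁ }
      ; edges⊆ = λ f∈H₁ → edges⊆ H₁⊑H₂ f∈H₁ ,
                   λ incident → v∉H₁ (incident⇒verts G₁ ds f∈H₁ (⊑-incident⁻ H₁⊑H₂ f∈H₁ incident))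
      ; agree  = agree H₁⊑H₂ }

    ⊑-edgeBlock : ∀ {e} → IsDecSubgraph G₁ H₁ → TwoConnOrK2 G₁ H₁ → H₁ ⊑ H₂ → edges H₁ e →
                  H₁ ⊑ edgeBlock G₂ H₂ e
    ⊑-edgeBlock ds (_ , noIsolated , connected) H₁⊑H₂ e∈H₁ = record
      { verts⊆ = λ {x} x∈H₁ → let (f , f∈H₁ , incident) = incidentEdge G₁ ds x∈H₁ (noIsolated x)
                             in f , edges⊆′ f∈H₁ , ⊑-incident H₁⊑H₂ f∈H₁ incident
      ; edges⊆ = edges⊆′
      ; agree  = agree H₁⊑H₂ }
      where
        edges⊆′ : ∀ {f} → edges H₁ f → edges (edgeBlock G₂ H₂ _) f
        edges⊆′ f∈H₁ = edges⊆ H₁⊑H₂ f∈H₁ , sameComp-⊑ H₁⊑H₂ (connected e∈H₁ f∈H₁)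

  ⊑-trans : ∀ {G₁ G₂ G₃ : Graph n m} {H₁ : SubG G₁} {H₂ : SubG G₂} {H₃ : SubG G₃} →
            H₁ ⊑ H₂ → H₂ ⊑ H₃ → H₁ ⊑ H₃
  ⊑-trans H₁⊑H₂ H₂⊑H₃ = record
    { verts⊆ = λ x∈H₁ → verts⊆ H₂⊑H₃ (verts⊆ H₁⊑H₂ x∈H₁)
    ; edges⊆ = λ f∈H₁ → edges⊆ H₂⊑H₃ (edges⊆ H₁⊑H₂ f∈H₁)
    ; agree  = λ f∈H₁ → trans (agree H₁⊑H₂ f∈H₁) (agree H₂⊑H₃ (edges⊆ H₁⊑H₂ f∈H₁)) }

  edgeBlock-⊑ : ∀ {G : Graph n m} {H : SubG G} {e} → IsDecSubgraph G H → edgeBlock G H e ⊑ H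
  edgeBlock-⊑ {G} ds = record { verts⊆ = edgeBlock-verts⊆ G ds ; edges⊆ = proj₁ ; agree = λ _ → refl }

  mutual
    td-mono : ∀ {G₁ G₂ : Graph n m} {H₁ : SubG G₁} {H₂ : SubG G₂} {k} → TD2≤ G₂ H₂ k → H₁ ⊑ H₂ →
              IsDecSubgraph G₁ H₁ → NonEmpty H₁ → TD2≤ G₁ H₁ k
    td-mono {G₂ = G₂} {k = zero} td H₁⊑H₂ _ (_ , x∈H₁) = ⊥-elim (td-0⇒empty G₂ td (verts⊆ H₁⊑H₂ x∈H₁))
    td-mono {G₁} {k = suc _} td H₁⊑H₂ ds ne = td-byBlocks G₁ ds ne (td-mono-2conn td H₁⊑H₂ ds)
      (λ {e} _ → td-mono-2conn td (⊑-trans (edgeBlock-⊑ ds) H₁⊑H₂) (edgeBlock-isDec G₁ ds e))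

    td-mono-2conn : ∀ {G₁ G₂ : Graph n m} {H₁ : SubG G₁} {H₂ : SubG G₂} {k} → TD2≤ G₂ H₂ k → H₁ ⊑ H₂ →
                    IsDecSubgraph G₁ H₁ → TwoConnOrK2 G₁ H₁ → TD2≤ G₁ H₁ k
    td-mono-2conn (td-base (_ , _ , unique)) H₁⊑H₂ _ ((a , b , a∈H₁ , b∈H₁ , a≢b) , _) =
      ⊥-elim (a≢b (trans (unique a (verts⊆ H₁⊑H₂ a∈H₁)) (sym (unique b (verts⊆ H₁⊑H₂ b∈H₁)))))
    td-mono-2conn {G₁} (td-blocks _ _ _ td-edge) H₁⊑H₂ ds tc@((a , _ , a∈H₁ , _) , noIsolated , _) =
      let (e , e∈H₁ , _) = incidentEdge G₁ ds a∈H₁ (noIsolated a)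
      in td-mono-2conn (td-edge e (edges⊆ H₁⊑H₂ e∈H₁)) (⊑-edgeBlock ds tc H₁⊑H₂ e∈H₁) ds tc
    td-mono-2conn {G₁} {H₁ = H₁} (td-split _ v _ td) H₁⊑H₂ ds tc@(two , _) with verts? ds v
    ... | yes v∈H₁ = td-split tc v v∈H₁ (td-mono td (⊑-deleteV {v = v} H₁⊑H₂)
                                          (deleteV-isDec G₁ ds v) (deleteV-nonEmpty G₁ {H₁} two v))
    ... | no v∉H₁ = td-suc G₁ (td-mono td (⊑-deleteV-absent ds H₁⊑H₂ v∉H₁) ds (twoConn-nonEmpty G₁ tc))

  td-deleteV : ∀ {G : Graph n m} {J : SubG G} {j v} → IsDecSubgraph G J → verts J v →
               (NonEmpty (deleteV G J v) → TD2≤ G (deleteV G J v) j) → TD2≤ G J (suc j)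
  td-deleteV {G} {J} {j} {v} ds v∈J td-J-v =
    td-byBlocks G ds (v , v∈J) (λ tc → td-split tc v v∈J (td-J-v (deleteV-nonEmpty G {J} (proj₁ tc) v)))
      td-block
    where
      td-block : ∀ {e} → edges J e → TwoConnOrK2 G (edgeBlock G J e) → TD2≤ G (edgeBlock G J e) (suc j)
      td-block {e} e∈J tc with verts? (edgeBlock-isDec G ds e) v
      ... | yes v∈B =
        let B-v⊑J-v = ⊑-deleteV {v = v} (edgeBlock-⊑ {e = e} ds)
            B-v≠∅ = deleteV-nonEmpty G {edgeBlock G J e} (proj₁ tc) v
        in td-split tc v v∈B (td-mono (td-J-v (⊑-nonEmpty B-v⊑J-v B-v≠∅)) B-v⊑J-v
                                      (deleteV-isDec G (edgeBlock-isDec G ds e) v) B-v≠∅)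
      ... | no v∉B =
        let B⊑J-v = ⊑-deleteV-absent (edgeBlock-isDec G ds e) (edgeBlock-⊑ {e = e} ds) v∉B
            B≠∅ = end₁ e , e , (e∈J , inj₁ refl) , inj₁ refl
        in td-suc G (td-mono (td-J-v (⊑-nonEmpty B⊑J-v B≠∅)) B⊑J-v (edgeBlock-isDec G ds e) B≠∅)
        where open Walks G

module Contraction {n m : ℕ} (G : Graph n m) (e : Fin m) where
  open Walks G
  open Subgraphs

  p q : Fin n
  p = end₁ e
  q = end₂ e

  -- G/e identifies p with q.  The edge e itself survives as a loop at q, which is why H /e
  -- drops it.
  merge : Fin n → Fin n
  merge w with w ≟ p
  ... | yes _ = q
  ... | no _ = w

  merge-p : merge p ≡ q
  merge-p with p ≟ p
  ... | yes _ = refl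
  ... | no p≢p = ⊥-elim (p≢p refl)

  merge-fixes : ∀ {w} → w ≢ p → merge w ≡ w
  merge-fixes {w} w≢p with w ≟ p
  ... | yes w≡p = ⊥-elim (w≢p w≡p)
  ... | no _ = refl

  G/e : Graph n m
  G/e f = merge (end₁ f) , merge (end₂ f)

  module W/e = Walks G/e

  joins-merge : ∀ {f x y} → Joins G f x y → Joins G/e f (merge x) (merge y)
  joins-merge (inj₁ eq) = inj₁ (cong (λ (a , b) → merge a , merge b) eq)
  joins-merge (inj₂ eq) = inj₂ (cong (λ (a , b) → merge a , merge b) eq)

  merge-q : p ≢ q → merge q ≡ q
  merge-q p≢q = merge-fixes (λ q≡p → p≢q (sym q≡p))

  merge-ends : p ≢ q → ∀ {x y} → Joins G e x y → merge x ≡ merge y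
  merge-ends p≢q (inj₁ refl) = trans merge-p (sym (merge-q p≢q))
  merge-ends p≢q (inj₂ refl) = trans (merge-q p≢q) (sym merge-p)

  contractWalk : ∀ {Z Z' : Fin m → Set} → p ≢ q → (∀ {z} → Z z → z ≢ e → Z' z) →
                 ∀ {x y} → Walk Z x y → W/e.Walk Z' (merge x) (merge y)
  contractWalk p≢q keep nil = W/e.nil
  contractWalk p≢q keep (cons f zf j w) with f ≟ e
  ... | yes refl = subst (λ v → W/e.Walk _ v _) (sym (merge-ends p≢q j)) (contractWalk p≢q keep w)
  ... | no f≢e = W/e.cons f (keep zf f≢e) (joins-merge j) (contractWalk p≢q keep w)

  walk-merged : ∀ {Z : Fin m → Set} {s t} → merge s ≡ merge t → Walk (λ z → Z z ⊎ z ≡ e) s t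
  -- The with-abstraction also evaluates merge s and merge t in the type of eq.
  walk-merged {s = s} {t} eq with s ≟ p | t ≟ p
  ... | yes refl | yes refl = nil
  ... | yes refl | no _ = subst (Walk _ p) eq (cons e (inj₂ refl) (inj₁ refl) nil)
  ... | no _ | yes refl = subst (λ v → Walk _ v p) (sym eq) (cons e (inj₂ refl) (inj₂ refl) nil)
  ... | no _ | no _ = subst (Walk _ s) eq nil

  liftWalk : ∀ {Z : Fin m → Set} {x y} → W/e.Walk Z x y → ∀ {s t} → merge s ≡ x → merge t ≡ y →
             Walk (λ z → Z z ⊎ z ≡ e) s t
  liftWalk W/e.nil s↦x t↦y = walk-merged (trans s↦x (sym t↦y))
  liftWalk (W/e.cons f zf (inj₁ eq) w) s↦x t↦y =
    walk-merged (trans s↦x (sym (cong proj₁ eq))) ++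
    cons f (inj₁ zf) (inj₁ refl) (liftWalk w (cong proj₂ eq) t↦y)
  liftWalk (W/e.cons f zf (inj₂ eq) w) s↦x t↦y =
    walk-merged (trans s↦x (sym (cong proj₂ eq))) ++
    cons f (inj₁ zf) (inj₂ refl) (liftWalk w (cong proj₁ eq) t↦y)

  acyclic-contract : ∀ {X} → e ∉ X → Acyclic G (X ∪ ⁅ e ⁆) → Acyclic G/e X
  acyclic-contract {X} e∉X acyclic c/e with W/e.cycle⇒bypassed c/e
  ... | f , f∈X , d/e =
    acyclic (bypassed⇒cycle (f , x∈p∪q⁺ (inj₁ f∈X) , map reroute (liftWalk d/e refl refl)))
    where
      reroute : ∀ {z} → (z ∈ X × z ≢ f) ⊎ z ≡ e → z ∈ X ∪ ⁅ e ⁆ × z ≢ f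
      reroute (inj₁ (z∈X , z≢f)) = x∈p∪q⁺ (inj₁ z∈X) , z≢f
      reroute (inj₂ refl) = x∈p∪q⁺ (inj₂ (x∈⁅x⁆ e)) , λ { refl → e∉X f∈X }

  cycle-other-edge : ∀ {X} → p ≢ q → (c : Cycle G X) → ∃ λ i → Cycle.edg c i ≢ e
  cycle-other-edge p≢q c@record { len = zero } = zero , λ edg₀≡e → p≢q (joins-loop
    (subst (λ f → Joins G f _ _) edg₀≡e (subst (Joins G _ _) (Cycle.closed c) (Cycle.edg-joins c zero))))
  cycle-other-edge p≢q c@record { len = suc _ } with Cycle.edg c zero ≟ e
  ... | no edg₀≢e = zero , edg₀≢e
  ... | yes edg₀≡e = suc zero , λ edg₁≡e →
    ℕ.1+n≢0 (cong toℕ (Cycle.edg-inj c (trans edg₁≡e (sym edg₀≡e))))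

  acyclic-⁅e⁆ : p ≢ q → Acyclic G ⁅ e ⁆
  acyclic-⁅e⁆ p≢q c =
    let (i , edg-i≢e) = cycle-other-edge p≢q c in edg-i≢e (x∈⁅y⁆⇒x≡y e (Cycle.edg-in c i))

  acyclic-uncontract : ∀ {X} → p ≢ q → Acyclic G/e X → Acyclic G (X ∪ ⁅ e ⁆)
  acyclic-uncontract {X} p≢q acyclic/e c =
    let (i , f≢e) = cycle-other-edge p≢q c
        keep : ∀ {z} → z ∈ X ∪ ⁅ e ⁆ × z ≢ Cycle.edg c i → z ≢ e → z ∈ X × z ≢ Cycle.edg c i
        keep = λ (z∈X∪e , z≢f) z≢e → x∈p∪q∧x∉q⇒x∈p z∈X∪e (x≢y⇒x∉⁅y⁆ z≢e) , z≢f
    in acyclic/e (W/e.bypassed⇒cycle (Cycle.edg c i , x∈p∪q∧x∉q⇒x∈p (Cycle.edg-in c i) (x≢y⇒x∉⁅y⁆ f≢e) ,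
                                       contractWalk p≢q keep (cycle-detour∈ c i)))

  _/e : SubG G → SubG G/e
  H /e = record { verts = λ x → verts H x × x ≢ p ; edges = λ f → edges H f × f ≢ e }

  deleteV²-⊑-/e : ∀ {H} → deleteV G (deleteV G H p) q ⊑ H /e
  deleteV²-⊑-/e = record
    { verts⊆ = proj₁
    ; edges⊆ = λ ((f∈H , ¬incident-p) , _) → f∈H , λ { refl → ¬incident-p (inj₁ refl) }
    ; agree  = λ ((_ , ¬incident-p) , _) → sym (cong₂ _,_ (merge-fixes (λ eq → ¬incident-p (inj₁ eq)))
                                                         (merge-fixes (λ eq → ¬incident-p (inj₂ eq)))) }

  module _ {H : SubG G} (ds : IsDecSubgraph G H) (e∈H : edges H e) (p≢q : p ≢ q) where

    merge∈ : ∀ {w} → verts H w → verts (H /e) (merge w)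
    merge∈ {w} w∈H with w ≟ p
    ... | yes _ = proj₂ (ends∈ ds e∈H) , λ q≡p → p≢q (sym q≡p)
    ... | no w≢p = w∈H , w≢p

    /e-isDec : IsDecSubgraph G/e (H /e)
    /e-isDec = record
      { verts? = λ x → verts? ds x ×-dec ¬? (x ≟ p)
      ; edges? = λ f → edges? ds f ×-dec ¬? (f ≟ e)
      ; ends∈  = λ (f∈H , _) → merge∈ (proj₁ (ends∈ ds f∈H)) , merge∈ (proj₂ (ends∈ ds f∈H)) }

    /e-nonEmpty : NonEmpty (H /e)
    /e-nonEmpty = q , proj₂ (ends∈ ds e∈H) , λ q≡p → p≢q (sym q≡p)

module TwoConnected {n m : ℕ} where
  open Subgraphs
  open Monotonicity

  deleteE : ∀ {G : Graph n m} → SubG G → Fin m → SubG G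
  deleteE H e = record { verts = verts H ; edges = λ f → edges H f × f ≢ e }

  deleteE-isDec : ∀ {G : Graph n m} {H e} → IsDecSubgraph G H → IsDecSubgraph G (deleteE H e)
  deleteE-isDec {e = e} ds = record
    { verts? = verts? ds
    ; edges? = λ f → edges? ds f ×-dec ¬? (f ≟ e)
    ; ends∈  = λ (f∈H , _) → ends∈ ds f∈H }

  td-2conn-singleEdge : ∀ {G : Graph n m} {H j} → IsDecSubgraph G H → TwoConnOrK2 G H →
                        (∀ {f g} → edges H f → edges H g → f ≡ g) → TD2≤ G H (suc (suc j))
  td-2conn-singleEdge {G} {H} ds tc@((a , b , a∈H , b∈H , a≢b) , noIsolated , _) single =
    td-split tc a a∈H (td-base (b , (b∈H , λ b≡a → a≢b (sym b≡a)) , only-b))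
    where
      open Walks G
      f = proj₁ (incidentEdge G ds a∈H (noIsolated a))
      f∈H = proj₁ (proj₂ (incidentEdge G ds a∈H (noIsolated a)))
      incident-f : ∀ {x} → verts H x → Incident G f x
      incident-f {x} x∈H = let (g , g∈H , incident-g) = incidentEdge G ds x∈H (noIsolated x)
                           in subst (λ h → Incident G h x) (single g∈H f∈H) incident-g
      only-b : ∀ x → verts (deleteV G H a) x → x ≡ b
      only-b x (x∈H , x≢a) = incident-other (incident-f a∈H) (incident-f b∈H) a≢b (incident-f x∈H) x≢a

  td-2conn-deleteEdge : ∀ {G : Graph n m} {H j e} → IsDecSubgraph G H → TwoConnOrK2 G H → edges H e →
                        TD2≤ G (deleteE H e) j → TD2≤ G H (suc (suc j))
  td-2conn-deleteEdge {G} {H} {e = e} ds tc e∈H td = td-split tc p p∈H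
    (td-suc G (td-mono td H-p⊑H-e (deleteV-isDec G ds p) (deleteV-nonEmpty G {H} (proj₁ tc) p)))
    where
      p = Walks.end₁ G e
      p∈H = proj₁ (ends∈ ds e∈H)
      H-p⊑H-e : deleteV G H p ⊑ deleteE H e
      H-p⊑H-e = record
        { verts⊆ = proj₁
        ; edges⊆ = λ (f∈H , ¬incident) → f∈H , λ { refl → ¬incident (inj₁ refl) }
        ; agree  = λ _ → refl }

  td-2conn-contract : ∀ {G : Graph n m} {H j e} → IsDecSubgraph G H → TwoConnOrK2 G H → edges H e →
                      Walks.end₁ G e ≢ Walks.end₂ G e →
                      TD2≤ (Contraction.G/e G e) (Contraction._/e G e H) j → TD2≤ G H (suc (suc j))
  td-2conn-contract {G} {H} {e = e} ds tc e∈H p≢q td =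
    td-split tc p p∈H (td-deleteV H-p-isDec (q∈H , λ q≡p → p≢q (sym q≡p))
      (td-mono td deleteV²-⊑-/e (deleteV-isDec G H-p-isDec q)))
    where
      open Contraction G e
      p∈H = proj₁ (ends∈ ds e∈H)
      q∈H = proj₂ (ends∈ ds e∈H)
      H-p-isDec = deleteV-isDec G ds p

module CdDepth {n m : ℕ} where
  open Subgraphs
  open TwoConnected

  -- Minors of M(G) are not literally cycle matroids, so the induction runs over matroids
  -- presented by a subgraph.
  record Represents {G : Graph n m} (M : SetSystem m) (H : SubG G) : Set where
    field
      ground⇒edges  : ∀ {x} → ground M x → edges H x
      edges⇒ground  : ∀ {x} → edges H x → ground M x
      indep⇒acyclic : ∀ {X} → (∀ x → x ∈ X → edges H x) → indep M X → Acyclic G X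
      acyclic⇒indep : ∀ {X} → (∀ x → x ∈ X → edges H x) → Acyclic G X → indep M X

  open Represents

  represents-cycleM : ∀ {G : Graph n m} {H : SubG G} → Represents (cycleM G H) H
  represents-cycleM = record
    { ground⇒edges  = λ x∈H → x∈H
    ; edges⇒ground  = λ x∈H → x∈H
    ; indep⇒acyclic = λ _ acyclic → acyclic
    ; acyclic⇒indep = λ _ acyclic → acyclic }

  module _ {G : Graph n m} {M : SetSystem m} {H : SubG G} (r : Represents M H) where

    circuit-represented : ∀ {C} → IsCircuit M C → IsCircuit (cycleM G H) C
    circuit-represented (C⊆M , dependent , minimal) =
      C⊆H , (λ acyclic → dependent (acyclic⇒indep r C⊆H acyclic)) ,
      λ x x∈C → indep⇒acyclic r (λ y y∈C-x → C⊆H y (x∈p-y⇒x∈p y∈C-x)) (minimal x x∈C)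
      where
        C⊆H = λ x x∈C → ground⇒edges r (C⊆M x x∈C)

    circuit-representative : ∀ {C} → IsCircuit (cycleM G H) C → IsCircuit M C
    circuit-representative (C⊆H , dependent , minimal) =
      (λ x x∈C → edges⇒ground r (C⊆H x x∈C)) , (λ indep → dependent (indep⇒acyclic r C⊆H indep)) ,
      λ x x∈C → acyclic⇒indep r (λ y y∈C-x → C⊆H y (x∈p-y⇒x∈p y∈C-x)) (minimal x x∈C)

    sameComp-represented : ∀ {e f} → SameComp M e f → SameComp (cycleM G H) e f
    sameComp-represented (inj₁ e≡f) = inj₁ e≡f
    sameComp-represented (inj₂ (C , circuit , e∈C , f∈C)) =
      inj₂ (C , circuit-represented circuit , e∈C , f∈C)

    sameComp-representative : ∀ {e f} → SameComp (cycleM G H) e f → SameComp M e f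
    sameComp-representative (inj₁ e≡f) = inj₁ e≡f
    sameComp-representative (inj₂ (C , circuit , e∈C , f∈C)) =
      inj₂ (C , circuit-representative circuit , e∈C , f∈C)

    -- Up to η, restrict M (ground M) is M and delete M e is a restriction of M.
    represents-restrict : ∀ {C : Fin m → Set} {H' : SubG G} → (∀ {x} → edges H' x → edges H x) →
                          (∀ {x} → C x → edges H' x) → (∀ {x} → edges H' x → C x) →
                          Represents (restrict M C) H'
    represents-restrict H'⊆H C⊆H' H'⊆C = record
      { ground⇒edges  = C⊆H'
      ; edges⇒ground  = H'⊆C
      ; indep⇒acyclic = λ X⊆H' → indep⇒acyclic r (λ x x∈X → H'⊆H (X⊆H' x x∈X))
      ; acyclic⇒indep = λ X⊆H' → acyclic⇒indep r (λ x x∈X → H'⊆H (X⊆H' x x∈X)) }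

    represents-component : ∀ {e} → Represents (restrict M (component M e)) (edgeBlock G H e)
    represents-component = represents-restrict proj₁
      (λ (x∈M , e~x) → ground⇒edges r x∈M , sameComp-represented e~x)
      (λ (x∈H , e~x) → edges⇒ground r x∈H , sameComp-representative e~x)

    represents-edgeBlock : ∀ {e} → (∀ {x} → ground M x → SameComp M e x) → Represents M (edgeBlock G H e)
    represents-edgeBlock e~all = represents-restrict proj₁
      (λ x∈M → ground⇒edges r x∈M , sameComp-represented (e~all x∈M))
      (λ (x∈H , _) → edges⇒ground r x∈H)

    represents-delete : ∀ {e} → Represents (delete M e) (deleteE H e)
    represents-delete = represents-restrict proj₁
      (λ (x∈M , x≢e) → ground⇒edges r x∈M , x≢e) (λ (x∈H , x≢e) → edges⇒ground r x∈H , x≢e)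

    represents-contract-loop : ∀ {e} → edges H e → Walks.end₁ G e ≡ Walks.end₂ G e →
                               Represents (contract M e) (deleteE H e)
    represents-contract-loop {e} e∈H loop = record
      { ground⇒edges  = λ (x∈M , x≢e) → ground⇒edges r x∈M , x≢e
      ; edges⇒ground  = λ (x∈H , x≢e) → edges⇒ground r x∈H , x≢e
      ; indep⇒acyclic = λ X⊆H (indep , _) → indep⇒acyclic r (λ x x∈X → proj₁ (X⊆H x x∈X)) indep
      ; acyclic⇒indep = λ X⊆H acyclic → acyclic⇒indep r (λ x x∈X → proj₁ (X⊆H x x∈X)) acyclic ,
                          λ e-indep → ⊥-elim (indep⇒acyclic r e⊆H e-indep (Walks.loop-cycle G e loop)) }
      where
        e⊆H : ∀ x → x ∈ ⁅ e ⁆ → edges H x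
        e⊆H x x∈e = subst (edges H) (sym (x∈⁅y⁆⇒x≡y e x∈e)) e∈H

    represents-contract : ∀ {e} → edges H e → Walks.end₁ G e ≢ Walks.end₂ G e →
                          Represents (contract M e) (Contraction._/e G e H)
    represents-contract {e} e∈H p≢q = record
      { ground⇒edges  = λ (x∈M , x≢e) → ground⇒edges r x∈M , x≢e
      ; edges⇒ground  = λ (x∈H , x≢e) → edges⇒ground r x∈H , x≢e
      ; indep⇒acyclic = λ X⊆H (_ , indep-X+e) → acyclic-contract (e∉ X⊆H)
                          (indep⇒acyclic r (X+e⊆H X⊆H) (indep-X+e (acyclic⇒indep r e⊆H (acyclic-⁅e⁆ p≢q))))
      ; acyclic⇒indep = λ X⊆H acyclic/e → let acyclic-X+e = acyclic-uncontract p≢q acyclic/e in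
          acyclic⇒indep r (λ x x∈X → proj₁ (X⊆H x x∈X))
                          (Walks.acyclic-⊆ G (λ x∈X → x∈p∪q⁺ (inj₁ x∈X)) acyclic-X+e) ,
          λ _ → acyclic⇒indep r (X+e⊆H X⊆H) acyclic-X+e }
      where
        open Contraction G e
        e⊆H : ∀ x → x ∈ ⁅ e ⁆ → edges H x
        e⊆H x x∈e = subst (edges H) (sym (x∈⁅y⁆⇒x≡y e x∈e)) e∈H
        e∉ : ∀ {X} → (∀ x → x ∈ X → edges H x × x ≢ e) → e ∉ X
        e∉ X⊆H e∈X = proj₂ (X⊆H e e∈X) refl
        X+e⊆H : ∀ {X} → (∀ x → x ∈ X → edges H x × x ≢ e) → ∀ x → x ∈ X ∪ ⁅ e ⁆ → edges H x
        X+e⊆H {X} X⊆H x x∈X+e = [ (λ x∈X → proj₁ (X⊆H x x∈X)) , e⊆H x ]′ (x∈p∪q⁻ X ⁅ e ⁆ x∈X+e)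

  ¬cdd≤0 : ∀ {M : SetSystem m} → ¬ CDD≤ M 0
  ¬cdd≤0 (cdd-disconnected ¬atMostOne _ cdd-component) =
    ¬atMostOne (λ {e} e∈M _ → ⊥-elim (¬cdd≤0 (cdd-component e e∈M)))

  td-2*suc : ∀ {G : Graph n m} {H k} → TD2≤ G H (suc (suc (2 * k))) → TD2≤ G H (2 * suc k)
  td-2*suc {G} {H} {k} = subst (TD2≤ G H) (sym (ℕ.*-suc 2 k))

  mutual
    td-bound : ∀ {G : Graph n m} {M H k} → CDD≤ M k → Represents M H → IsDecSubgraph G H → NonEmpty H →
               TD2≤ G H (2 * k)
    td-bound {k = zero} cdd _ _ _ = ⊥-elim (¬cdd≤0 cdd)
    td-bound {G} {k = suc _} cdd r ds ne =
      td-byBlocks G ds ne (td-bound-2conn cdd r ds) (td-bound-edgeBlock cdd r ds)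

    td-bound-edgeBlock : ∀ {G : Graph n m} {M H k e} → CDD≤ M k → Represents M H → IsDecSubgraph G H →
                         edges H e → TwoConnOrK2 G (edgeBlock G H e) → TD2≤ G (edgeBlock G H e) (2 * k)
    td-bound-edgeBlock {G} {e = e} cdd@(cdd-base atMostOne) r ds e∈H =
      td-bound-2conn cdd (represents-edgeBlock r (λ x∈M → inj₁ (atMostOne (edges⇒ground r e∈H) x∈M)))
                     (edgeBlock-isDec G ds e)
    td-bound-edgeBlock {G} {e = e} (cdd-disconnected _ _ cdd-component) r ds e∈H =
      td-bound-2conn (cdd-component e (edges⇒ground r e∈H)) (represents-component r)
                     (edgeBlock-isDec G ds e)
    td-bound-edgeBlock {G} {e = e} cdd@(cdd-connected _ connected _ _ _) r ds e∈H =
      td-bound-2conn cdd (represents-edgeBlock r (connected (edges⇒ground r e∈H))) (edgeBlock-isDec G ds e)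

    td-bound-2conn : ∀ {G : Graph n m} {M H k} → CDD≤ M k → Represents M H → IsDecSubgraph G H →
                     TwoConnOrK2 G H → TD2≤ G H (2 * k)
    td-bound-2conn (cdd-base atMostOne) r ds tc =
      td-2*suc (td-2conn-singleEdge ds tc (λ f∈H g∈H → atMostOne (edges⇒ground r f∈H) (edges⇒ground r g∈H)))
    td-bound-2conn (cdd-disconnected _ ¬connected _) r _ (_ , _ , connected) =
      ⊥-elim (¬connected λ e∈M f∈M → sameComp-representative r (connected (ground⇒edges r e∈M)
                                                                            (ground⇒edges r f∈M)))
    td-bound-2conn {G} (cdd-connected _ _ e e∈M (inj₂ cdd∖e)) r ds tc =
      td-2*suc (td-2conn-deleteEdge ds tc (ground⇒edges r e∈M)
        (td-bound cdd∖e (represents-delete r) (deleteE-isDec ds) (twoConn-nonEmpty G tc)))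
    td-bound-2conn (cdd-connected _ _ e e∈M (inj₁ cdd/e)) r ds tc =
      td-2*suc (td-bound-contract cdd/e r ds tc (ground⇒edges r e∈M))

    td-bound-contract : ∀ {G : Graph n m} {M H k e} → CDD≤ (contract M e) k → Represents M H →
                        IsDecSubgraph G H → TwoConnOrK2 G H → edges H e → TD2≤ G H (suc (suc (2 * k)))
    td-bound-contract {G} {e = e} cdd/e r ds tc e∈H with Walks.end₁ G e ≟ Walks.end₂ G e
    ... | yes loop = td-2conn-deleteEdge ds tc e∈H
      (td-bound cdd/e (represents-contract-loop r e∈H loop) (deleteE-isDec ds) (twoConn-nonEmpty G tc))
    ... | no p≢q = td-2conn-contract ds tc e∈H p≢q
      (td-bound cdd/e (represents-contract r e∈H p≢q) (/e-isDec ds e∈H p≢q) (/e-nonEmpty ds e∈H p≢q))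
      where open Contraction G e

open CdDepth using (td-bound; represents-cycleM)
open Subgraphs using (fullG-isDec)

mainTheorem18 : (n m : ℕ) (G : Graph n m) → 1 ≤ n → (k : ℕ) →
    CDD≤ (cycleM G (fullG G)) k → TD2≤ G (fullG G) (2 * k)
mainTheorem18 (suc n) m G _ k cdd = td-bound cdd represents-cycleM (fullG-isDec G) (zero , tt)
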